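{- Let $\mathbb A$ be a finite relational structure which is a core and which contains, for every $a\in A$, the unary relation $\{a\}$ among its relations. If $\mathbb A$ is unbalanced, then $\mathrm{CSP}(\mathbb A)$ is solvable by the $(1)$-minimality algorithm, i.e., for every instance $\mathcal I$ of $\mathrm{CSP}(\mathbb A)$, the $(1)$-minimality algorithm turns $\mathcal I$ into a trivial instance if and only if $\mathcal I$ has no solution.
   Context: A finite structure is a core if every endomorphism is an automorphism. An instance of $\mathrm{CSP}(\mathbb A)$ is a pair $(\mathcal V,\mathcal C)$ with $\mathcal V$ a finite set of variables and $\mathcal C$ a finite set of constraints; each constraint $C$ has a nonempty scope $U\subseteq\mathcal V$, $C\subseteq A^U$, and for some enumeration $u_1,\dots,u_n$ of $U$ and some relation $R$ of $\mathbb A$, $f\in C$ iff $(f(u_1),\dots,f(u_n))\in R$. A solution is $f:\mathcal V\to A$ with $f|_U\in C$ for every constraint $C$ with scope $U$. An instance is trivial if it contains an empty constraint. For a constraint $C$ and variable $u$ in its scope, $\mathrm{proj}_u(C)=\{f|_{\{u\}}:f\in C\}$. An instance is $(1)$-minimal if every variable lies in the scope of some constraint and for every variable $u$, all constraints whose scope contains $u$ have the same projection onto $u$. The $(1)$-minimality algorithm transforms (in polynomial time) any instance into a $(1)$-minimal instance with the same solution set, which is an instance of $\mathrm{CSP}(\mathbb A')$ where $\mathbb A'$ is the expansion of $\mathbb A$ by all unary $\mathbb A$-definable relations. An $\mathbb A$-formula is a primitive positive formula whose atoms use only relation symbols of $\mathbb A$ (no equality atoms unless equality is in the signature); $\mathbb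 A$-definable means definable by an $\mathbb A$-formula; $\phi^{\mathbb A}$ is the set of satisfying assignments of the free variables; $\mathrm{proj}_{(u)}(\phi^{\mathbb A})=\{f(u):f\in\phi^{\mathbb A}\}$. For nonempty $\mathbb A$-definable $C,D\subseteq A$ and distinct free variables $u,v$ of an $\mathbb A$-formula $\phi$: $\phi$ is a $(C,u,D,v)$-implication if $C\subsetneq\mathrm{proj}_{(u)}(\phi^{\mathbb A})$, $D\subsetneq\mathrm{proj}_{(v)}(\phi^{\mathbb A})$, every $f\in\phi^{\mathbb A}$ with $f(u)\in C$ has $f(v)\in D$, and every $a\in D$ equals $f(v)$ for some $f\in\phi^{\mathbb A}$ with $f(u)\in C$. It is balanced if $C=D$ and $\mathrm{proj}_{(u)}(\phi^{\mathbb A})=\mathrm{proj}_{(v)}(\phi^{\mathbb A})$. $\mathbb A$ is unbalanced if no $\mathbb A$-formula is a balanced implication in $\mathbb A$. -}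

module Defs where

open import Level using (0ℓ)
open import Data.Nat using (ℕ; _≤_)
open import Data.Fin using (Fin)
open import Data.Vec using (Vec; map; lookup)
open import Data.Bool using (Bool; true)
open import Data.Sum using (_⊎_; [_,_])
open import Data.Product using (Σ; ∃; _×_; _,_)
open import Data.List using (List)
open import Data.List.Relation.Unary.All using (All)
open import Data.List.Membership.Propositional using (_∈_)
open import Relation.Unary using (Pred)
open import Relation.Nullary using (¬_)
open import Relation.Binary.PropositionalEquality using (_≡_; _≢_)
open import Function.Bundles using (_⇔_)

-- Domain A = Fin n, finitely many relation symbols Fin m, symbol i has
-- arity ar i, and its interpretation is given by a (decidable)
-- characteristic function on tuples.

record Structure : Set where
  field
    n   : ℕ
    m   : ℕ
    ar  : Fin m → ℕ
    rel : (i : Fin m) → Vec (Fin n) (ar i) → Bool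

module _ (𝔸 : Structure) where
  open Structure 𝔸

  A : Set
  A = Fin n

  IsEndomorphism : (A → A) → Set
  IsEndomorphism h =
    ∀ (i : Fin m) (t : Vec A (ar i)) → rel i t ≡ true → rel i (map h t) ≡ true

  IsAutomorphism : (A → A) → Set
  IsAutomorphism h =
    Σ (A → A) λ g →
      (∀ a → g (h a) ≡ a) × (∀ a → h (g a) ≡ a) ×
      IsEndomorphism h × IsEndomorphism g

  IsCore : Set
  IsCore = ∀ (h : A → A) → IsEndomorphism h → IsAutomorphism h

  HasSingletons : Set
  HasSingletons =
    ∀ (a : A) → Σ (Fin m) λ i →
      (ar i ≡ 1) × (∀ (t : Vec A (ar i)) → (rel i t ≡ true) ⇔ (∀ k → lookup t k ≡ a))

  -- 𝔸-formulas (primitive positive, atoms are relation symbols of 𝔸 only)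
  -- with k free variables (Fin k) and e existentially quantified ones
  -- (Fin e).

  record Formula (k : ℕ) : Set where
    field
      e     : ℕ
      atoms : List (Σ (Fin m) λ i → Vec (Fin k ⊎ Fin e) (ar i))

  Sat : ∀ {k} → Formula k → (Fin k → A) → Set
  Sat φ f = ∃ λ (g : Fin (Formula.e φ) → A) →
    All (λ { (i , xs) → rel i (map [ f , g ] xs) ≡ true }) (Formula.atoms φ)

  Proj : ∀ {k} → Formula k → Fin k → Pred A 0ℓ
  Proj φ u a = ∃ λ f → Sat φ f × f u ≡ a

  Definable : Pred A 0ℓ → Set
  Definable C = Σ (Formula 1) λ φ → ∀ a → C a ⇔ Sat φ (λ _ → a)

  Nonempty : Pred A 0ℓ → Set
  Nonempty C = ∃ λ a → C a

  _⊊_ : Pred A 0ℓ → Pred A 0ℓ → Set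
  C ⊊ P = (∀ a → C a → P a) × (∃ λ a → P a × ¬ C a)

  IsImplication : ∀ {k} → Pred A 0ℓ → Fin k → Pred A 0ℓ → Fin k → Formula k → Set
  IsImplication C u D v φ =
    Nonempty C × Definable C × Nonempty D × Definable D × u ≢ v ×
    C ⊊ Proj φ u × D ⊊ Proj φ v ×
    (∀ f → Sat φ f → C (f u) → D (f v)) ×
    (∀ a → D a → ∃ λ f → Sat φ f × C (f u) × f v ≡ a)

  IsBalancedImplication : ∀ {k} → Pred A 0ℓ → Fin k → Pred A 0ℓ → Fin k → Formula k → Set
  IsBalancedImplication C u D v φ =
    IsImplication C u D v φ × (∀ a → C a ⇔ D a) × (∀ a → Proj φ u a ⇔ Proj φ v a)

  Unbalanced : Set₁
  Unbalanced =
    ∀ (k : ℕ) (φ : Formula k) (C D : Pred A 0ℓ) (u v : Fin k) →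
      ¬ IsBalancedImplication C u D v φ

  -- A constraint is given by
  -- a relation symbol R and an enumeration u_1..u_r (injective tuple of
  -- variables, r ≥ 1) of its scope U; it is {f ∈ A^U | (f u_1..f u_r) ∈ R}.

  record Constraint (N : ℕ) : Set where
    field
      sym      : Fin m
      scope    : Vec (Fin N) (ar sym)
      nonempty : 1 ≤ ar sym
      distinct : ∀ j l → lookup scope j ≡ lookup scope l → j ≡ l

  record Instance : Set where
    field
      N           : ℕ
      constraints : List (Constraint N)

  IsSolution : (I : Instance) → (Fin (Instance.N I) → A) → Set
  IsSolution I f = ∀ c → c ∈ Instance.constraints I →
    rel (Constraint.sym c) (map f (Constraint.scope c)) ≡ true

  HasSolution : Instance → Set
  HasSolution I = ∃ λ f → IsSolution I f

  -- It repeatedly removes from the domain D_u of each variable u the values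
  -- that are not in the projection onto u of some constraint restricted to
  -- the current domains.  Its final domains are the greatest family
  -- (D_u)_u of subsets of A such that for every constraint c with
  -- enumeration u_1..u_r and every position j, every a ∈ D_{u_j} extends
  -- to a tuple t ∈ R_c with t_j = a and t_l ∈ D_{u_l} for all l.
  -- The output instance consists of the original constraints restricted to
  -- the final domains together with the unary constraints D_u on each u.

  Consistent : (I : Instance) → (Fin (Instance.N I) → Pred A 0ℓ) → Set
  Consistent I D = ∀ c → c ∈ Instance.constraints I →
    ∀ j a → D (lookup (Constraint.scope c) j) a →
      ∃ λ (t : Vec A (ar (Constraint.sym c))) →
        rel (Constraint.sym c) t ≡ true × lookup t j ≡ a ×
        (∀ l → D (lookup (Constraint.scope c) l) (lookup t l))

  -- final domains: the greatest consistent family (union of all such)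
  FinalDomain : (I : Instance) → Fin (Instance.N I) → A → Set₁
  FinalDomain I u a =
    ∃ λ (D : Fin (Instance.N I) → Pred A 0ℓ) → Consistent I D × D u a

  -- the output instance contains an empty constraint: either a restricted
  -- original constraint or a unary constraint D_u is empty
  OneMinimalityTrivial : Instance → Set₁
  OneMinimalityTrivial I =
    (∃ λ c → c ∈ Instance.constraints I ×
       ¬ (∃ λ (t : Vec A (ar (Constraint.sym c))) →
            rel (Constraint.sym c) t ≡ true ×
            (∀ l → FinalDomain I (lookup (Constraint.scope c) l) (lookup t l))))
    ⊎ (∃ λ u → ∀ a → ¬ FinalDomain I u a)

  SolvableBy1Minimality : Set₁
  SolvableBy1Minimality =
    ∀ (I : Instance) → OneMinimalityTrivial I ⇔ (¬ HasSolution I)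

-- A solution yields a consistent family of singleton domains, so the (1)-minimality algorithm
-- never trivialises a solvable instance. Conversely, arc consistency computes the greatest
-- consistent family of (definable) domains; if one of them is empty the output is trivial, so
-- the point is that a consistent family G of nonempty definable domains has a solution.
--
-- This goes by induction on the total size of G. If every domain is a singleton, these values
-- form a solution. Otherwise restrict some domain G u to a singleton C, which is definable. If
-- the restricted family is consistent, induction applies. If not, some constraint through u
-- and another variable v has a value in G v that lost its support; projecting the G-tuples of
-- that constraint onto (u, v) gives a pp-definable implication from C ⊊ G u to the new support
-- set C′ ⊊ G v, and we continue with (v, C′). Implications compose and there are finitely many
-- pairs (v, C′), so some pair recurs, and the composed implication from it to itself is
-- balanced, which the hypothesis excludes.

{-# OPTIONS --safe #-}
module Submission where

open import Defs
open import Level using (0ℓ)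
open import Data.Nat using (ℕ; zero; suc; _+_; _*_; _^_; _≤_; _<_; z≤n; s≤s; z<s; s<s)
open import Data.Nat.Properties using (≤-refl; +-mono-≤; +-mono-<-≤; +-mono-≤-<; n<1+n)
open import Data.Nat.Induction using (<-wellFounded)
open import Data.Fin as Fin
  using (Fin; zero; suc; toℕ; fromℕ<; _↑ˡ_; _↑ʳ_; splitAt; combine; funToFin; finToFun)
open import Data.Fin.Properties using (any?; all?; pigeonhole; splitAt-↑ˡ; splitAt-↑ʳ;
  combine-injective; finToFun-funToFin; ∀-cons-⇔; ¬∀⟶∃¬) renaming (_≟_ to _≟ᶠ_)
open import Data.Vec using (Vec; []; _∷_; map; lookup; tabulate; allFin)
open import Data.Vec.Functional using (updateAt)
open import Data.Vec.Functional.Properties using (updateAt-updates; updateAt-minimal)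
open import Data.Vec.Properties using (map-∘; map-cong; lookup-map; lookup∘tabulate; tabulate∘lookup;
  tabulate-cong; tabulate-allFin)
open import Data.Bool using (Bool; true; false; T)
open import Data.Bool.Properties using () renaming (_≟_ to _≟ᵇ_)
open import Data.Sum as Sum using (_⊎_; inj₁; inj₂; [_,_]; [_,_]′)
open import Data.Product using (Σ; ∃; ∃₂; _×_; _,_; proj₁; proj₂)
open import Data.List as List using (_++_)
open import Data.List.Relation.Unary.All as All using (All)
import Data.List.Relation.Unary.Any as Any
open import Data.List.Membership.Propositional using (_∈_; find; lose)
open import Data.Vec.Relation.Binary.Pointwise.Extensional using (ext; Pointwise-≡⇒≡)
open import Data.List.Relation.Unary.All.Properties using (map⁺; map⁻; ++⁺; ++⁻)
open import Data.Unit using (⊤; tt)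
open import Data.Empty using (⊥-elim)
open import Function using (_∘_; const; _⇔_; mk⇔; Injective)
open import Function.Bundles using (module Equivalence)
import Function.Properties.Equivalence as ⇔
open import Induction.WellFounded using (Acc; acc)
open import Relation.Nullary using (¬_; Dec; yes; no)
open import Relation.Nullary.Decidable using (_×-dec_; toWitness; fromWitness; T?; decidable-stable)
import Relation.Nullary.Decidable as Dec
open import Relation.Unary using (Pred; Decidable)
open import Relation.Binary.PropositionalEquality
  using (_≡_; _≢_; _≗_; refl; sym; trans; cong; subst; module ≡-Reasoning)

open Equivalence

-- Finite search and counting

∃-vec? : ∀ {ℓ k q} {P : Pred (Vec (Fin q) k) ℓ} → Decidable P → Dec (∃ P)
∃-vec? {k = zero}  P? = Dec.map′ ([] ,_) (λ { ([] , p) → p }) (P? [])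
∃-vec? {k = suc k} P? =
  Dec.map′ (λ (a , t , p) → a ∷ t , p) (λ { (a ∷ t , p) → a , t , p })
           (any? λ a → ∃-vec? (P? ∘ (a ∷_)))

∑ : ∀ {k} → (Fin k → ℕ) → ℕ
∑ {zero}  f = 0
∑ {suc k} f = f zero + ∑ (f ∘ suc)

∑-mono-≤ : ∀ {k} {f g : Fin k → ℕ} → (∀ x → f x ≤ g x) → ∑ f ≤ ∑ g
∑-mono-≤ {zero}  f≤g = z≤n
∑-mono-≤ {suc k} f≤g = +-mono-≤ (f≤g zero) (∑-mono-≤ (f≤g ∘ suc))

∑-mono-< : ∀ {k} {f g : Fin k → ℕ} → (∀ x → f x ≤ g x) → ∀ x → f x < g x → ∑ f < ∑ g
∑-mono-< f≤g zero    f<g = +-mono-<-≤ f<g (∑-mono-≤ (f≤g ∘ suc))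
∑-mono-< f≤g (suc x) f<g = +-mono-≤-< (f≤g zero) (∑-mono-< (f≤g ∘ suc) x f<g)

bit : Bool → Fin 2
bit false = zero
bit true  = suc zero

bit-injective : ∀ {b b′} → bit b ≡ bit b′ → b ≡ b′
bit-injective {false} {false} _ = refl
bit-injective {true}  {true}  _ = refl

bit-mono-≤ : ∀ {b b′} → (T b → T b′) → toℕ (bit b) ≤ toℕ (bit b′)
bit-mono-≤ {false}         _ = z≤n
bit-mono-≤ {true}  {true}  _ = ≤-refl
bit-mono-≤ {true}  {false} h = ⊥-elim (h tt)

bit-mono-< : ∀ {b b′} → ¬ T b → T b′ → toℕ (bit b) < toℕ (bit b′)
bit-mono-< {false} {true} _ _ = s≤s z≤n
bit-mono-< {true}         b _ = ⊥-elim (b tt)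

module KeyedIteration {ℓ} {S R : Set} (_↝_ : S → S → Set ℓ)
                      (↝-trans : ∀ {s t u} → s ↝ t → t ↝ u → s ↝ u)
                      {K : ℕ} (key : S → Fin K) (key-changes : ∀ {s t} → s ↝ t → key s ≢ key t)
                      (step : ∀ s → R ⊎ ∃ (s ↝_)) where

  Chain : ∀ {t} → Vec S t → Set ℓ
  Chain seq = ∀ {i j} → i Fin.< j → lookup seq i ↝ lookup seq j

  ∷-chain : ∀ {t s s′} {rest : Vec S t} → s ↝ s′ → Chain (s′ ∷ rest) → Chain (s ∷ s′ ∷ rest)
  ∷-chain s↝s′ ch {zero}  {suc zero}    _         = s↝s′
  ∷-chain s↝s′ ch {zero}  {suc (suc j)} _         = ↝-trans s↝s′ (ch {zero} {suc j} z<s)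
  ∷-chain s↝s′ ch {suc i} {suc j}       (s<s i<j) = ch i<j

  iterate : ∀ t s → R ⊎ Σ (Vec S t) (λ rest → Chain (s ∷ rest))
  iterate zero    s = inj₂ ([] , λ { {zero} {zero} () })
  iterate (suc t) s with step s
  ... | inj₁ r          = inj₁ r
  ... | inj₂ (s′ , s↝s′) =
    Sum.map₂ (λ (rest , ch) → s′ ∷ rest , ∷-chain s↝s′ ch) (iterate t s′)

  -- K + 1 chained states cannot have pairwise distinct keys.
  result : S → R
  result s with iterate K s
  ... | inj₁ r         = r
  ... | inj₂ (rest , ch) with i , j , i<j , same ← pigeonhole (n<1+n K) (key ∘ lookup (s ∷ rest)) =
    ⊥-elim (key-changes (ch i<j) same)

-- Implications between binary relations

_⨾_ : ∀ {X : Set} → (X → X → Set) → (X → X → Set) → X → X → Set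
(R ⨾ R′) x z = ∃ λ y → R x y × R′ y z

-- The semantic content of a (C,u,D,v)-implication whose formula defines R, with P and Q the
-- projections onto u and v.
record Implication {X : Set} (P Q C D : Pred X 0ℓ) (R : X → X → Set) : Set where
  field
    related⇒dom : ∀ {x y} → R x y → P x × Q y
    dom⇒related : ∀ {x} → P x → ∃ (R x)
    cod⇒related : ∀ {y} → Q y → ∃ λ x → R x y
    implies     : ∀ {x y} → R x y → C x → D y
    onto        : ∀ {y} → D y → ∃ λ x → R x y × C x

Implication-compose : ∀ {X} {P Q S C D E : Pred X 0ℓ} {R R′} →
  Implication P Q C D R → Implication Q S D E R′ → Implication P S C E (R ⨾ R′)
Implication-compose I J = record
  { related⇒dom = λ (y , r , r′) → proj₁ (I.related⇒dom r) , proj₂ (J.related⇒dom r′)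
  ; dom⇒related = λ p → let y , r = I.dom⇒related p
                            z , r′ = J.dom⇒related (proj₂ (I.related⇒dom r))
                        in z , y , r , r′
  ; cod⇒related = λ s → let y , r′ = J.cod⇒related s
                            x , r = I.cod⇒related (proj₁ (J.related⇒dom r′))
                        in x , y , r , r′
  ; implies     = λ (y , r , r′) c → J.implies r′ (I.implies r c)
  ; onto        = λ e → let y , r′ , d = J.onto e
                            x , r , c = I.onto d
                        in x , (y , r , r′) , c
  }
  where module I = Implication I
        module J = Implication J

-- Primitive positive definability

module _ (𝔸 : Structure) where
  open Structure 𝔸

  private
    Carrier : Set
    Carrier = A 𝔸

  Atom : Set → Set
  Atom X = Σ (Fin m) λ i → Vec X (ar i)

  Holds : ∀ {X} → (X → Carrier) → Atom X → Set
  Holds f (i , xs) = rel i (map f xs) ≡ true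

  rename : ∀ {X Y} → (X → Y) → Atom X → Atom Y
  rename ρ (i , xs) = i , map ρ xs

  Holds-cong : ∀ {X} {f g : X → Carrier} → f ≗ g → ∀ a → Holds f a → Holds g a
  Holds-cong f≗g (i , xs) = subst (λ t → rel i t ≡ true) (map-cong f≗g xs)

  Holds-rename : ∀ {X Y} {ρ : X → Y} {f : Y → Carrier} {g : X → Carrier} → f ∘ ρ ≗ g →
                 ∀ a → Holds f (rename ρ a) ⇔ Holds g a
  Holds-rename {ρ = ρ} {f} fρ≗g (i , xs) =
    mk⇔ (subst (λ t → rel i t ≡ true) eq) (subst (λ t → rel i t ≡ true) (sym eq))
    where eq = trans (sym (map-∘ f ρ xs)) (map-cong fρ≗g xs)

  All-rename : ∀ {X Y} {ρ : X → Y} {f : Y → Carrier} {g : X → Carrier} → f ∘ ρ ≗ g →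
               ∀ as → All (Holds f) (List.map (rename ρ) as) ⇔ All (Holds g) as
  All-rename fρ≗g as =
    mk⇔ (All.map (to (Holds-rename fρ≗g _)) ∘ map⁻) (map⁺ ∘ All.map (from (Holds-rename fρ≗g _)))

  Sat-cong : ∀ {k} (φ : Formula 𝔸 k) {f g} → f ≗ g → Sat 𝔸 φ f → Sat 𝔸 φ g
  Sat-cong φ f≗g (h , holds) =
    h , All.map (Holds-cong (λ { (inj₁ x) → f≗g x ; (inj₂ _) → refl }) _) holds

  PPDefinable : ∀ k → Pred (Fin k → Carrier) 0ℓ → Set
  PPDefinable k P = Σ (Formula 𝔸 k) λ φ → ∀ f → P f ⇔ Sat 𝔸 φ f

  Definable₂ : (Carrier → Carrier → Set) → Set
  Definable₂ R = PPDefinable 2 (λ f → R (f zero) (f (suc zero)))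

  PPDefinable⇒Definable : ∀ {C} → PPDefinable 1 (λ f → C (f zero)) → Definable 𝔸 C
  PPDefinable⇒Definable (φ , C⇔φ) = φ , λ a → C⇔φ (λ _ → a)

  Definable⇒PPDefinable : ∀ {C} → Definable 𝔸 C → PPDefinable 1 (λ f → C (f zero))
  Definable⇒PPDefinable (φ , C⇔φ) = φ , λ f →
    mk⇔ (Sat-cong φ (λ { zero → refl }) ∘ to (C⇔φ (f zero)))
        (from (C⇔φ (f zero)) ∘ Sat-cong φ (λ { zero → refl }))

  PPDefinable-resp : ∀ {k P Q} → (∀ f → P f ⇔ Q f) → PPDefinable k P → PPDefinable k Q
  PPDefinable-resp P⇔Q (φ , P⇔φ) = φ , λ f → ⇔.trans (⇔.sym (P⇔Q f)) (P⇔φ f)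

  ⊤-definable : ∀ {k} → PPDefinable k (λ _ → ⊤)
  ⊤-definable = record { e = 0 ; atoms = List.[] } , λ f → mk⇔ (λ _ → (λ ()) , All.[]) (λ _ → tt)

  rel-definable : ∀ i → PPDefinable (ar i) (λ g → rel i (tabulate g) ≡ true)
  rel-definable i = record { e = 0 ; atoms = List.[ i , map inj₁ (allFin (ar i)) ] } , λ g →
    mk⇔ (λ r → (λ ()) , subst (λ t → rel i t ≡ true) (tabulate≡ g) r All.∷ All.[])
        (λ { (_ , r All.∷ All.[]) → subst (λ t → rel i t ≡ true) (sym (tabulate≡ g)) r })
    where
      tabulate≡ : ∀ {h : Fin 0 → Carrier} g → tabulate g ≡ map [ g , h ] (map inj₁ (allFin (ar i)))
      tabulate≡ {h} g = trans (tabulate-allFin g) (map-∘ [ g , h ] inj₁ (allFin (ar i)))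

  ×-definable : ∀ {k P Q} → PPDefinable k P → PPDefinable k Q → PPDefinable k (λ f → P f × Q f)
  ×-definable {k} (φ , P⇔φ) (ψ , Q⇔ψ) = φ∧ψ , λ f → mk⇔ (both f) (split f)
    where
      open Formula φ using () renaming (e to e₁; atoms to atoms₁)
      open Formula ψ using () renaming (e to e₂; atoms to atoms₂)

      ρ₁ : Fin k ⊎ Fin e₁ → Fin k ⊎ Fin (e₁ + e₂)
      ρ₁ = Sum.map₂ (_↑ˡ e₂)

      ρ₂ : Fin k ⊎ Fin e₂ → Fin k ⊎ Fin (e₁ + e₂)
      ρ₂ = Sum.map₂ (e₁ ↑ʳ_)

      φ∧ψ : Formula 𝔸 k
      φ∧ψ = record
        { e     = e₁ + e₂
        ; atoms = List.map (rename ρ₁) atoms₁ ++ List.map (rename ρ₂) atoms₂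
        }

      both : ∀ f → _ → Sat 𝔸 φ∧ψ f
      both f (p , q) with g₁ , s₁ ← to (P⇔φ f) p | g₂ , s₂ ← to (Q⇔ψ f) q =
        g , ++⁺ (from (All-rename eq₁ atoms₁) s₁) (from (All-rename eq₂ atoms₂) s₂)
        where
          g : Fin (e₁ + e₂) → Carrier
          g = [ g₁ , g₂ ] ∘ splitAt e₁
          eq₁ : [ f , g ] ∘ ρ₁ ≗ [ f , g₁ ]
          eq₁ (inj₁ _) = refl
          eq₁ (inj₂ y) = cong [ g₁ , g₂ ]′ (splitAt-↑ˡ e₁ y e₂)
          eq₂ : [ f , g ] ∘ ρ₂ ≗ [ f , g₂ ]
          eq₂ (inj₁ _) = refl
          eq₂ (inj₂ y) = cong [ g₁ , g₂ ]′ (splitAt-↑ʳ e₁ e₂ y)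

      split : ∀ f → Sat 𝔸 φ∧ψ f → _
      split f (g , s) with s₁ , s₂ ← ++⁻ (List.map (rename ρ₁) atoms₁) s =
        from (P⇔φ f) (g ∘ (_↑ˡ e₂) , to (All-rename eq₁ atoms₁) s₁) ,
        from (Q⇔ψ f) (g ∘ (e₁ ↑ʳ_) , to (All-rename eq₂ atoms₂) s₂)
        where
          eq₁ : [ f , g ]′ ∘ ρ₁ ≗ [ f , g ∘ (_↑ˡ e₂) ]′
          eq₁ (inj₁ _) = refl
          eq₁ (inj₂ _) = refl
          eq₂ : [ f , g ]′ ∘ ρ₂ ≗ [ f , g ∘ (e₁ ↑ʳ_) ]′
          eq₂ (inj₁ _) = refl
          eq₂ (inj₂ _) = refl

  substitution-definable : ∀ {k k′ d P} → PPDefinable k P → (σ : Fin k → Fin k′ ⊎ Fin d) →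
                           PPDefinable k′ (λ f → ∃ λ (h : Fin d → Carrier) → P ([ f , h ] ∘ σ))
  substitution-definable {k} {k′} {d} (φ , P⇔φ) σ = φσ , λ f → mk⇔ (instantiate f) (recover f)
    where
      open Formula φ using (e; atoms)

      τ : Fin k ⊎ Fin e → Fin k′ ⊎ Fin (d + e)
      τ = [ Sum.map₂ (_↑ˡ e) ∘ σ , inj₂ ∘ (d ↑ʳ_) ]

      φσ : Formula 𝔸 k′
      φσ = record { e = d + e ; atoms = List.map (rename τ) atoms }

      instantiate : ∀ f → _ → Sat 𝔸 φσ f
      instantiate f (h , p) with g , s ← to (P⇔φ _) p = [ h , g ] ∘ splitAt d , from (All-rename eq atoms) s
        where
          eq : [ f , [ h , g ]′ ∘ splitAt d ]′ ∘ τ ≗ [ [ f , h ]′ ∘ σ , g ]′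
          eq (inj₁ x) with σ x
          ... | inj₁ _ = refl
          ... | inj₂ z = cong [ h , g ]′ (splitAt-↑ˡ d z e)
          eq (inj₂ y) = cong [ h , g ]′ (splitAt-↑ʳ d e y)

      recover : ∀ f → Sat 𝔸 φσ f → _
      recover f (g , s) = g ∘ (_↑ˡ e) , from (P⇔φ _) (g ∘ (d ↑ʳ_) , to (All-rename eq atoms) s)
        where
          eq : [ f , g ]′ ∘ τ ≗ [ [ f , g ∘ (_↑ˡ e) ]′ ∘ σ , g ∘ (d ↑ʳ_) ]′
          eq (inj₁ x) with σ x
          ... | inj₁ _ = refl
          ... | inj₂ _ = refl
          eq (inj₂ _) = refl

  rename-definable : ∀ {k k′ P} → PPDefinable k P → (ρ : Fin k → Fin k′) →
                     PPDefinable k′ (λ f → P (f ∘ ρ))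
  rename-definable D ρ =
    PPDefinable-resp (λ f → mk⇔ proj₂ ((λ ()) ,_)) (substitution-definable {d = 0} D (inj₁ ∘ ρ))

  ∀-definable : ∀ {k r} {P : Fin r → Pred (Fin k → Carrier) 0ℓ} →
                (∀ l → PPDefinable k (P l)) → PPDefinable k (λ f → ∀ l → P l f)
  ∀-definable {r = zero}  _ = PPDefinable-resp (λ f → mk⇔ (λ _ ()) _) ⊤-definable
  ∀-definable {r = suc r} D =
    PPDefinable-resp (λ f → ∀-cons-⇔) (×-definable (D zero) (∀-definable (D ∘ suc)))

  project-definable : ∀ {r k} {P : Pred (Vec Carrier r) 0ℓ} → PPDefinable r (P ∘ tabulate) →
                      (ι : Fin k → Fin r) → Injective _≡_ _≡_ ι →
                      PPDefinable k (λ f → ∃ λ t → P t × ∀ x → lookup t (ι x) ≡ f x)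
  project-definable {r} {k} {P} D ι ι-injective =
    PPDefinable-resp (λ f → mk⇔ (restrict f) (extend f)) (substitution-definable D σ)
    where
      σ : Fin r → Fin k ⊎ Fin r
      σ l with any? (λ x → ι x ≟ᶠ l)
      ... | yes (x , _) = inj₁ x
      ... | no _        = inj₂ l

      σ-ι : ∀ x → σ (ι x) ≡ inj₁ x
      σ-ι x with any? (λ y → ι y ≟ᶠ ι x)
      ... | yes (y , ιy≡ιx) = cong inj₁ (ι-injective ιy≡ιx)
      ... | no ∄y           = ⊥-elim (∄y (x , refl))

      restrict : ∀ f → (∃ λ h → P (tabulate ([ f , h ] ∘ σ))) → _
      restrict f (h , p) = tabulate ([ f , h ] ∘ σ) , p , λ x →
        trans (lookup∘tabulate ([ f , h ] ∘ σ) (ι x)) (cong [ f , h ] (σ-ι x))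

      extend : ∀ f → (∃ λ t → P t × ∀ x → lookup t (ι x) ≡ f x) →
               ∃ λ h → P (tabulate ([ f , h ] ∘ σ))
      extend f (t , p , pinned) = lookup t , subst P (sym (trans (tabulate-cong agree) (tabulate∘lookup t))) p
        where
          agree : [ f , lookup t ] ∘ σ ≗ lookup t
          agree l with any? (λ x → ι x ≟ᶠ l)
          ... | yes (x , refl) = sym (pinned x)
          ... | no _           = refl

  ⨾-definable : ∀ {R R′} → Definable₂ R → Definable₂ R′ → Definable₂ (R ⨾ R′)
  ⨾-definable {R} {R′} D D′ =
    PPDefinable-resp (λ f → mk⇔ (λ (h , rr′) → h zero , rr′) (λ (y , rr′) → (λ _ → y) , rr′))
      (substitution-definable (×-definable (rename-definable D first) (rename-definable D′ second)) middle)
    where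
      first second : Fin 2 → Fin 3
      first  = lookup (zero ∷ suc zero ∷ [])
      second = lookup (suc zero ∷ suc (suc zero) ∷ [])

      middle : Fin 3 → Fin 2 ⊎ Fin 1
      middle = lookup (inj₁ zero ∷ inj₂ zero ∷ inj₁ (suc zero) ∷ [])

  -- Definable subsets of A

  -- Membership is decidable so that the domains can be computed with; definability lets them
  -- occur in 𝔸-formulas.
  record DefSubset : Set where
    field
      χ         : Carrier → Bool
      definable : Definable 𝔸 (T ∘ χ)

  open DefSubset public

  _∋_ : DefSubset → Pred Carrier 0ℓ
  S ∋ a = T (χ S a)

  full : DefSubset
  full = record { χ = const true ; definable = PPDefinable⇒Definable ⊤-definable }

  singleton : HasSingletons 𝔸 → Carrier → DefSubset
  singleton hasSingletons a = record
    { χ         = λ b → Dec.isYes (b ≟ᶠ a)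
    ; definable = PPDefinable⇒Definable
                    (PPDefinable-resp (λ f → mk⇔ (R⇒≡ (f zero)) (≡⇒R (f zero)))
                      (rename-definable (rel-definable i) (const zero)))
    }
    where
      i = proj₁ (hasSingletons a)
      ar≡1 = proj₁ (proj₂ (hasSingletons a))
      R⇔a = proj₂ (proj₂ (hasSingletons a))

      R⇒≡ : ∀ b → rel i (tabulate (const b)) ≡ true → Dec.True (b ≟ᶠ a)
      R⇒≡ b r = fromWitness (trans (sym (lookup∘tabulate (const b) k)) (to (R⇔a _) r k))
        where k = subst Fin (sym ar≡1) zero

      ≡⇒R : ∀ b → Dec.True (b ≟ᶠ a) → rel i (tabulate (const b)) ≡ true
      ≡⇒R b b≡a = from (R⇔a _) λ k → trans (lookup∘tabulate (const b) k) (toWitness b≡a)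

  code : DefSubset → Fin (2 ^ n)
  code S = funToFin (bit ∘ χ S)

  code-injective : ∀ {S S′} → code S ≡ code S′ → ∀ a → χ S a ≡ χ S′ a
  code-injective {S} {S′} eq a = bit-injective (begin
    bit (χ S a)                 ≡⟨ finToFun-funToFin (bit ∘ χ S) a ⟨
    finToFun (code S) a         ≡⟨ cong (λ x → finToFun x a) eq ⟩
    finToFun (code S′) a        ≡⟨ finToFun-funToFin (bit ∘ χ S′) a ⟩
    bit (χ S′ a)                ∎)
    where open ≡-Reasoning

  record ProperSubset (P : Pred Carrier 0ℓ) : Set where
    field
      subset   : DefSubset
      nonempty : Nonempty 𝔸 (subset ∋_)
      proper   : _⊊_ 𝔸 (subset ∋_) P

  open ProperSubset public

  singleton-proper : HasSingletons 𝔸 → ∀ {P a b} → P a → P b → a ≢ b → ProperSubset P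
  singleton-proper hasSingletons {P} {a} {b} a∈P b∈P a≢b = record
    { subset   = singleton hasSingletons a
    ; nonempty = a , fromWitness refl
    ; proper   = (λ x x≡a → subst P (sym (toWitness x≡a)) a∈P) , b , b∈P , a≢b ∘ sym ∘ toWitness
    }

  Proj-⇔ : ∀ {P Q C D R} → ((φ , R⇔φ) : Definable₂ R) → Implication P Q C D R →
           ∀ a → (Proj 𝔸 φ zero a ⇔ P a) × (Proj 𝔸 φ (suc zero) a ⇔ Q a)
  Proj-⇔ (φ , R⇔φ) I a =
    mk⇔ (λ { (f , s , refl) → proj₁ (related⇒dom (from (R⇔φ f) s)) })
        (λ p → let y , r = dom⇒related p in lookup (a ∷ y ∷ []) , to (R⇔φ _) r , refl) ,
    mk⇔ (λ { (f , s , refl) → proj₂ (related⇒dom (from (R⇔φ f) s)) })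
        (λ q → let x , r = cod⇒related q in lookup (x ∷ a ∷ []) , to (R⇔φ _) r , refl)
    where open Implication I

  ⊊-resp : ∀ {C P Q} → (∀ a → P a ⇔ Q a) → _⊊_ 𝔸 C P → _⊊_ 𝔸 C Q
  ⊊-resp P⇔Q (C⊆P , a , Pa , a∉C) = (λ b → to (P⇔Q b) ∘ C⊆P b) , a , to (P⇔Q a) Pa , a∉C

  Implication⇒IsImplication :
    ∀ {P Q R} → ((φ , _) : Definable₂ R) → (X : ProperSubset P) (Y : ProperSubset Q) →
    Implication P Q (subset X ∋_) (subset Y ∋_) R →
    IsImplication 𝔸 (subset X ∋_) zero (subset Y ∋_) (suc zero) φ
  Implication⇒IsImplication (φ , R⇔φ) X Y I =
    nonempty X , definable (subset X) , nonempty Y , definable (subset Y) , (λ ()) ,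
    ⊊-resp (λ a → ⇔.sym (proj₁ (Proj-⇔ (φ , R⇔φ) I a))) (proper X) ,
    ⊊-resp (λ a → ⇔.sym (proj₂ (Proj-⇔ (φ , R⇔φ) I a))) (proper Y) ,
    (λ f s → implies (from (R⇔φ f) s)) ,
    (λ b d → let x , r , c = onto d in lookup (x ∷ b ∷ []) , to (R⇔φ _) r , c , refl)
    where open Implication I

  Implication⇒IsBalancedImplication :
    ∀ {P Q R} → ((φ , _) : Definable₂ R) → (X : ProperSubset P) (Y : ProperSubset Q) →
    Implication P Q (subset X ∋_) (subset Y ∋_) R →
    (∀ a → P a ⇔ Q a) → (∀ a → χ (subset X) a ≡ χ (subset Y) a) →
    IsBalancedImplication 𝔸 (subset X ∋_) zero (subset Y ∋_) (suc zero) φ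
  Implication⇒IsBalancedImplication R-def X Y I P⇔Q same-χ =
    Implication⇒IsImplication R-def X Y I ,
    (λ a → mk⇔ (subst T (same-χ a)) (subst T (sym (same-χ a)))) ,
    (λ a → ⇔.trans (proj₁ (Proj-⇔ R-def I a)) (⇔.trans (P⇔Q a) (⇔.sym (proj₂ (Proj-⇔ R-def I a)))))

  -- Families of domains for an instance

  module _ (I : Instance 𝔸) where
    open Instance I

    arity : Constraint 𝔸 N → ℕ
    arity c = ar (Constraint.sym c)

    var : (c : Constraint 𝔸 N) → Fin (arity c) → Fin N
    var c l = lookup (Constraint.scope c) l

    Family : Set
    Family = Fin N → DefSubset

    ⟦_⟧ : Family → Fin N → Pred Carrier 0ℓ
    ⟦ G ⟧ u = G u ∋_

    _⊑_ : (Fin N → Pred Carrier 0ℓ) → (Fin N → Pred Carrier 0ℓ) → Set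
    D ⊑ E = ∀ u a → D u a → E u a

    Within : (Fin N → Pred Carrier 0ℓ) → (c : Constraint 𝔸 N) → Pred (Vec Carrier (arity c)) 0ℓ
    Within D c t = ∀ l → D (var c l) (lookup t l)

    Fits : (Fin N → Pred Carrier 0ℓ) → (c : Constraint 𝔸 N) → Pred (Vec Carrier (arity c)) 0ℓ
    Fits D c t = rel (Constraint.sym c) t ≡ true × Within D c t

    -- Phrased exactly as in Consistent, which therefore says that every value is Supported.
    Supported : (Fin N → Pred Carrier 0ℓ) → (c : Constraint 𝔸 N) → Fin (arity c) → Pred Carrier 0ℓ
    Supported D c j a = ∃ λ t → rel (Constraint.sym c) t ≡ true × lookup t j ≡ a × Within D c t

    Supported-mono : ∀ {D E c j a} → D ⊑ E → Supported D c j a → Supported E c j a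
    Supported-mono D⊑E (t , r , tj , within) = t , r , tj , λ l → D⊑E _ _ (within l)

    Supported? : ∀ G c j → Decidable (Supported ⟦ G ⟧ c j)
    Supported? G c j a = ∃-vec? λ t →
      (rel (Constraint.sym c) t ≟ᵇ true) ×-dec (lookup t j ≟ᶠ a) ×-dec
      all? (λ l → T? (χ (G (var c l)) (lookup t l)))

    Fits-definable : ∀ G c → PPDefinable (arity c) (Fits ⟦ G ⟧ c ∘ tabulate)
    Fits-definable G c = ×-definable (rel-definable (Constraint.sym c)) (∀-definable λ l →
      PPDefinable-resp (λ g → mk⇔ (subst (G (var c l) ∋_) (sym (lookup∘tabulate g l)))
                                  (subst (G (var c l) ∋_) (lookup∘tabulate g l)))
        (rename-definable (Definable⇒PPDefinable (definable (G (var c l)))) (const l)))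

    support : Family → (c : Constraint 𝔸 N) → Fin (arity c) → DefSubset
    support G c j = record
      { χ         = λ a → Dec.isYes (Supported? G c j a)
      ; definable = PPDefinable⇒Definable (PPDefinable-resp (λ f → mk⇔ (witness f) (projection f))
                      (project-definable (Fits-definable G c) (const j) injective))
      }
      where
        injective : Injective _≡_ _≡_ (const j)
        injective {zero}  {zero}  _ = refl
        injective {suc ()}
        injective {y = suc ()}

        witness : ∀ f → (∃ λ t → Fits ⟦ G ⟧ c t × ∀ x → lookup t j ≡ f x) →
                  Dec.True (Supported? G c j (f zero))
        witness f (t , (r , within) , tj) = fromWitness (t , r , tj zero , within)

        projection : ∀ f → Dec.True (Supported? G c j (f zero)) →
                     ∃ λ t → Fits ⟦ G ⟧ c t × ∀ x → lookup t j ≡ f x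
        projection f a∈ with t , r , tj , within ← toWitness a∈ = t , (r , within) , λ { zero → tj ; (suc ()) }

    support-⊆ : ∀ {G c j a} → support G c j ∋ a → G (var c j) ∋ a
    support-⊆ {G} a∈ with t , _ , refl , within ← toWitness a∈ = within _

    TupleProjection : Family → (c : Constraint 𝔸 N) → (p j : Fin (arity c)) → Carrier → Carrier → Set
    TupleProjection G c p j x y = ∃ λ t → Fits ⟦ G ⟧ c t × lookup t p ≡ x × lookup t j ≡ y

    TupleProjection-definable : ∀ G c {p j} → p ≢ j → Definable₂ (TupleProjection G c p j)
    TupleProjection-definable G c {p} {j} p≢j =
      PPDefinable-resp (λ f → mk⇔ (λ (t , F , pinned) → t , F , pinned zero , pinned (suc zero))
                                  (λ (t , F , tp , tj) → t , F , λ { zero → tp ; (suc zero) → tj }))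
        (project-definable (Fits-definable G c) (lookup (p ∷ j ∷ [])) injective)
      where
        injective : Injective _≡_ _≡_ (lookup (p ∷ j ∷ []))
        injective {zero}     {zero}     _   = refl
        injective {zero}     {suc zero} p≡j = ⊥-elim (p≢j p≡j)
        injective {suc zero} {zero}     j≡p = ⊥-elim (p≢j (sym j≡p))
        injective {suc zero} {suc zero} _   = refl

    _[_≔_] : Family → Fin N → DefSubset → Family
    G [ u ≔ S ] = updateAt G u (const S)

    ≔-at : ∀ {G u S w} → w ≡ u → (G [ u ≔ S ]) w ≡ S
    ≔-at {G} {u} refl = updateAt-updates u G

    ≔-other : ∀ {G u S w} → w ≢ u → (G [ u ≔ S ]) w ≡ G w
    ≔-other {G} {u} {w = w} w≢u = updateAt-minimal w u G w≢u

    ≔-⊑ : ∀ {G u S} → (∀ a → S ∋ a → G u ∋ a) → ⟦ G [ u ≔ S ] ⟧ ⊑ ⟦ G ⟧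
    ≔-⊑ {G} {u} S⊆Gu w a a∈ with w ≟ᶠ u
    ... | yes refl = S⊆Gu a (subst (_∋ a) (≔-at {G} refl) a∈)
    ... | no w≢u   = subst (_∋ a) (≔-other {G} w≢u) a∈

    ⊑-≔ : ∀ {E G u S} → E ⊑ ⟦ G ⟧ → (∀ a → E u a → S ∋ a) → E ⊑ ⟦ G [ u ≔ S ] ⟧
    ⊑-≔ {G = G} {u} E⊑G Eu⊆S w a a∈ with w ≟ᶠ u
    ... | yes refl = subst (_∋ a) (sym (≔-at {G} refl)) (Eu⊆S a a∈)
    ... | no w≢u   = subst (_∋ a) (sym (≔-other {G} w≢u)) (E⊑G w a a∈)

    size : Family → ℕ
    size G = ∑ λ u → ∑ λ a → toℕ (bit (χ (G u) a))

    size-< : ∀ {G H} → ⟦ G ⟧ ⊑ ⟦ H ⟧ → ∀ {u a} → H u ∋ a → ¬ G u ∋ a → size G < size H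
    size-< G⊑H {u} {a} a∈H a∉G =
      ∑-mono-< (λ w → ∑-mono-≤ (λ b → bit-mono-≤ (G⊑H w b))) u
        (∑-mono-< (λ b → bit-mono-≤ (G⊑H u b)) a (bit-mono-< a∉G a∈H))

    Violation : Family → Set
    Violation G = ∃ λ c → c ∈ constraints × ∃₂ λ j a → G (var c j) ∋ a × ¬ Supported ⟦ G ⟧ c j a

    violation? : ∀ G → Violation G ⊎ Consistent 𝔸 I ⟦ G ⟧
    violation? G with Any.any? (λ c → any? λ j → any? λ a →
                                  T? (χ (G (var c j)) a) ×-dec Dec.¬? (Supported? G c j a)) constraints
    ... | yes violated = inj₁ (find violated)
    ... | no ¬violated = inj₂ λ c c∈ j a a∈ →
      decidable-stable (Supported? G c j a) λ unsupported → ¬violated (lose c∈ (j , a , a∈ , unsupported))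

    record GreatestConsistentBelow (D : Family) : Set₁ where
      field
        G          : Family
        consistent : Consistent 𝔸 I ⟦ G ⟧
        greatest   : ∀ E → Consistent 𝔸 I E → E ⊑ ⟦ D ⟧ → E ⊑ ⟦ G ⟧

    greatest-consistent : ∀ D → GreatestConsistentBelow D
    greatest-consistent D = go D (<-wellFounded (size D))
      where
        go : ∀ D → Acc _<_ (size D) → GreatestConsistentBelow D
        go D (acc smaller) with violation? D
        ... | inj₂ consistent = record { G = D ; consistent = consistent ; greatest = λ _ _ E⊑D → E⊑D }
        ... | inj₁ (c , c∈ , j , a , a∈ , unsupported) = record
          { G          = G
          ; consistent = consistent
          ; greatest   = λ E E-consistent E⊑D → greatest E E-consistent (⊑-≔ E⊑D λ b b∈E →
                           fromWitness (Supported-mono {c = c} E⊑D (E-consistent c c∈ j b b∈E)))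
          }
          where
            D′ = D [ var c j ≔ support D c j ]
            a∉D′ : ¬ D′ (var c j) ∋ a
            a∉D′ = unsupported ∘ toWitness ∘ subst (_∋ a) (≔-at {D} refl)
            D′<D : size D′ < size D
            D′<D = size-< {D′} {D} (≔-⊑ (λ _ → support-⊆ {D} {c} {j})) a∈ a∉D′
            open GreatestConsistentBelow (go D′ (smaller D′<D))

    graph : (Fin N → Carrier) → Fin N → Pred Carrier 0ℓ
    graph f u a = f u ≡ a

    solution⇒FinalDomain : ∀ {f} → IsSolution 𝔸 I f → ∀ u → FinalDomain 𝔸 I u (f u)
    solution⇒FinalDomain {f} solution u = graph f , graph-consistent , refl
      where
        graph-consistent : Consistent 𝔸 I (graph f)
        graph-consistent c c∈ j a fj≡a =
          map f (Constraint.scope c) , solution c c∈ , trans (lookup-map j f (Constraint.scope c)) fj≡a ,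
          λ l → sym (lookup-map l f (Constraint.scope c))

    trivial⇒unsolvable : OneMinimalityTrivial 𝔸 I → ¬ HasSolution 𝔸 I
    trivial⇒unsolvable (inj₁ (c , c∈ , no-tuple)) (f , solution) =
      no-tuple (map f (Constraint.scope c) , solution c c∈ , λ l →
        subst (FinalDomain 𝔸 I (var c l)) (sym (lookup-map l f (Constraint.scope c)))
          (solution⇒FinalDomain solution _))
    trivial⇒unsolvable (inj₂ (u , empty)) (f , solution) = empty (f u) (solution⇒FinalDomain solution u)

    two-values? : ∀ (G : Family) → (∃ λ u → ∃₂ λ (a b : Carrier) → G u ∋ a × G u ∋ b × a ≢ b) ⊎
                                   (∀ u a b → G u ∋ a → G u ∋ b → a ≡ b)
    two-values? G with any? (λ u → any? λ a → any? λ b →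
                               T? (χ (G u) a) ×-dec T? (χ (G u) b) ×-dec Dec.¬? (a ≟ᶠ b))
    ... | yes found = inj₁ found
    ... | no ¬found = inj₂ λ u a b a∈ b∈ →
      decidable-stable (a ≟ᶠ b) λ a≢b → ¬found (u , a , b , a∈ , b∈ , a≢b)

    singleton-valued⇒solution : ∀ (G : Family) → Consistent 𝔸 I ⟦ G ⟧ → (∀ u → ∃ (G u ∋_)) →
                                (∀ u a b → G u ∋ a → G u ∋ b → a ≡ b) → HasSolution 𝔸 I
    singleton-valued⇒solution G consistent inhabited unique = f , solution
      where
        f : Fin N → Carrier
        f u = proj₁ (inhabited u)

        within⇒≡ : ∀ {c t} → Within ⟦ G ⟧ c t → t ≡ map f (Constraint.scope c)
        within⇒≡ {c} within = Pointwise-≡⇒≡ (ext λ l →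
          trans (unique _ _ _ (within l) (proj₂ (inhabited _))) (sym (lookup-map l f (Constraint.scope c))))

        solution : IsSolution 𝔸 I f
        solution c c∈ with j ← fromℕ< (Constraint.nonempty c)
                      with t , r , _ , within ← consistent c c∈ j _ (proj₂ (inhabited (var c j))) =
          subst (λ t → rel (Constraint.sym c) t ≡ true) (within⇒≡ {c} {t} within) r

    -- Consistent families with nonempty domains are solvable

    module Shrinking (unbalanced : Unbalanced 𝔸) (G : Family) (G-consistent : Consistent 𝔸 I ⟦ G ⟧)
                     (G-inhabited : ∀ u → ∃ (G u ∋_))
                     (smaller-solvable : ∀ G′ → size G′ < size G → Consistent 𝔸 I ⟦ G′ ⟧ →
                                         (∀ u → ∃ (G′ u ∋_)) → HasSolution 𝔸 I) where

      record Restriction : Set where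
        field
          u    : Fin N
          part : ProperSubset (G u ∋_)

        C : DefSubset
        C = subset part

        C⊆G : ∀ {a} → C ∋ a → G u ∋ a
        C⊆G = proj₁ (proper part) _

      open Restriction

      restricted : Restriction → Family
      restricted s = G [ u s ≔ C s ]

      restricted-⊑ : ∀ s → ⟦ restricted s ⟧ ⊑ ⟦ G ⟧
      restricted-⊑ s = ≔-⊑ {G} (proj₁ (proper (part s)))

      restricted-< : ∀ s → size (restricted s) < size G
      restricted-< s with a , a∈G , a∉C ← proj₂ (proper (part s)) =
        size-< {restricted s} {G} (restricted-⊑ s) a∈G (a∉C ∘ subst (_∋ a) (≔-at {G} refl))

      restricted-inhabited : ∀ s w → ∃ (restricted s w ∋_)
      restricted-inhabited s w with w ≟ᶠ u s
      ... | yes refl = let a , a∈C = nonempty (part s) in a , subst (_∋ a) (sym (≔-at {G} refl)) a∈C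
      ... | no w≢u   = let a , a∈G = G-inhabited w in a , subst (_∋ a) (sym (≔-other {G} w≢u)) a∈G

      -- The scope of a constraint is injective, so u occurs in it at most at position p.
      lift : ∀ s {c t} p → var c p ≡ u s → C s ∋ lookup t p →
             Within ⟦ G ⟧ c t → Within ⟦ restricted s ⟧ c t
      lift s {c} {t} p p↦u tp∈C within l with var c l ≟ᶠ u s
      ... | yes l↦u with refl ← Constraint.distinct c l p (trans l↦u (sym p↦u)) =
        subst (_∋ lookup t l) (sym (≔-at {G} l↦u)) tp∈C
      ... | no l↛u = subst (_∋ lookup t l) (sym (≔-other {G} l↛u)) (within l)

      record _↝_ (s s′ : Restriction) : Set₁ where
        constructor link
        field
          relation    : Carrier → Carrier → Set
          definable₂  : Definable₂ relation
          implication : Implication (G (u s) ∋_) (G (u s′) ∋_) (C s ∋_) (C s′ ∋_) relation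

      ↝-trans : ∀ {s s′ s″} → s ↝ s′ → s′ ↝ s″ → s ↝ s″
      ↝-trans (link R R-definable R-implication) (link R′ R′-definable R′-implication) =
        link (R ⨾ R′) (⨾-definable {R} {R′} R-definable R′-definable)
             (Implication-compose R-implication R′-implication)

      key : Restriction → Fin (N * 2 ^ n)
      key s = combine (u s) (code (C s))

      key-changes : ∀ {s s′} → s ↝ s′ → key s ≢ key s′
      key-changes {s} {s′} (link R R-definable R-implication) same-key =
        unbalanced 2 (proj₁ R-definable) (C s ∋_) (C s′ ∋_) zero (suc zero)
          (Implication⇒IsBalancedImplication R-definable (part s) (part s′) R-implication
            (λ a → mk⇔ (subst (λ w → G w ∋ a) same-u) (subst (λ w → G w ∋ a) (sym same-u)))
            (code-injective {C s} {C s′} same-code))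
        where
          same-u = proj₁ (combine-injective (u s) (code (C s)) (u s′) (code (C s′)) same-key)
          same-code = proj₂ (combine-injective (u s) (code (C s)) (u s′) (code (C s′)) same-key)

      supported-at-u : ∀ s {c} → c ∈ constraints → ∀ p {x} → var c p ≡ u s → C s ∋ x →
                       Supported ⟦ restricted s ⟧ c p x
      supported-at-u s {c} c∈ p {x} p↦u x∈C
        with t , r , refl , within ← G-consistent c c∈ p x (subst (λ w → G w ∋ x) (sym p↦u) (C⊆G s x∈C)) =
        t , r , refl , lift s {c} {t} p p↦u x∈C within

      module Propagate (s : Restriction) {c} (c∈ : c ∈ constraints) (j : Fin (arity c)) (a : Carrier)
                       (a∈ : restricted s (var c j) ∋ a) (unsupported : ¬ Supported ⟦ restricted s ⟧ c j a)
                       (j↛u : var c j ≢ u s) where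

        a∈G : G (var c j) ∋ a
        a∈G = subst (_∋ a) (≔-other {G} j↛u) a∈

        -- The support of a in G leaves the restricted family, which can only happen at u.
        u-in-scope : ∃ λ p → var c p ≡ u s
        u-in-scope with t , r , tj , within ← G-consistent c c∈ j a a∈G
                   with p , tp∉ ← ¬∀⟶∃¬ _ _ (λ l → T? (χ (restricted s (var c l)) (lookup t l)))
                                   (λ within′ → unsupported (t , r , tj , within′)) =
          p , decidable-stable (var c p ≟ᶠ u s) λ p↛u →
                tp∉ (subst (_∋ lookup t p) (sym (≔-other {G} p↛u)) (within p))

        p = proj₁ u-in-scope
        p↦u = proj₂ u-in-scope

        C′ : DefSubset
        C′ = support (restricted s) c j

        C′-nonempty : Nonempty 𝔸 (C′ ∋_)
        C′-nonempty with x , x∈C ← nonempty (part s)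
                    with t , r , refl , within ← supported-at-u s c∈ p p↦u x∈C =
          lookup t j , fromWitness (t , r , refl , within)

        next : Restriction
        next = record { u = var c j ; part = record
          { subset   = C′
          ; nonempty = C′-nonempty
          ; proper   = (λ b → restricted-⊑ s _ b ∘ support-⊆ {restricted s} {c} {j}) ,
                       a , a∈G , unsupported ∘ toWitness
          } }

        implication : Implication (G (u s) ∋_) (G (var c j) ∋_) (C s ∋_) (C′ ∋_) (TupleProjection G c p j)
        implication = record
          { related⇒dom = λ { (t , (_ , within) , refl , refl) →
                              subst (λ w → G w ∋ lookup t p) p↦u (within p) , within j }
          ; dom⇒related = λ {x} x∈ →
              let t , r , tp , within = G-consistent c c∈ p x (subst (λ w → G w ∋ x) (sym p↦u) x∈)
              in lookup t j , t , (r , within) , tp , refl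
          ; cod⇒related = λ {y} y∈ →
              let t , r , tj , within = G-consistent c c∈ j y y∈
              in lookup t p , t , (r , within) , refl , tj
          ; implies     = λ { (t , (r , within) , refl , refl) x∈C →
                              fromWitness (t , r , refl , lift s {c} {t} p p↦u x∈C within) }
          ; onto        = λ y∈ →
              let t , r , tj , within = toWitness y∈
              in lookup t p , (t , (r , λ l → restricted-⊑ s _ _ (within l)) , refl , tj) ,
                 subst (_∋ lookup t p) (≔-at {G} p↦u) (within p)
          }

        propagated : ∃ (s ↝_)
        propagated = next , link (TupleProjection G c p j)
                                 (TupleProjection-definable G c λ p≡j → j↛u (subst (λ l → var c l ≡ u s) p≡j p↦u))
                                 implication

      step : ∀ s → HasSolution 𝔸 I ⊎ ∃ (s ↝_)
      step s with violation? (restricted s)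
      ... | inj₂ consistent =
        inj₁ (smaller-solvable (restricted s) (restricted-< s) consistent (restricted-inhabited s))
      ... | inj₁ (c , c∈ , j , a , a∈ , unsupported) with var c j ≟ᶠ u s
      ...   | no j↛u   = inj₂ (Propagate.propagated s c∈ j a a∈ unsupported j↛u)
      ...   | yes j↦u = ⊥-elim (unsupported (supported-at-u s c∈ j j↦u (subst (_∋ a) (≔-at {G} j↦u) a∈)))

      solution : Restriction → HasSolution 𝔸 I
      solution = KeyedIteration.result _↝_ ↝-trans key key-changes step

    module _ (hasSingletons : HasSingletons 𝔸) (unbalanced : Unbalanced 𝔸) where

      consistent⇒solvable : ∀ G → Consistent 𝔸 I ⟦ G ⟧ → (∀ u → ∃ (G u ∋_)) → HasSolution 𝔸 I
      consistent⇒solvable G = go G (<-wellFounded (size G))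
        where
          go : ∀ G → Acc _<_ (size G) → Consistent 𝔸 I ⟦ G ⟧ → (∀ u → ∃ (G u ∋_)) → HasSolution 𝔸 I
          go G (acc smaller) consistent inhabited with two-values? G
          ... | inj₂ unique = singleton-valued⇒solution G consistent inhabited unique
          ... | inj₁ (u , a , b , a∈ , b∈ , a≢b) =
            Shrinking.solution unbalanced G consistent inhabited (λ G′ lt → go G′ (smaller lt))
              (record { u = u ; part = singleton-proper hasSingletons a∈ b∈ a≢b })

      open GreatestConsistentBelow (greatest-consistent (const full))
        renaming (G to Final; consistent to Final-consistent; greatest to Final-greatest)

      unsolvable⇒trivial : ¬ HasSolution 𝔸 I → OneMinimalityTrivial 𝔸 I
      unsolvable⇒trivial unsolvable with all? (λ u → any? λ a → T? (χ (Final u) a))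
      ... | yes inhabited = ⊥-elim (unsolvable (consistent⇒solvable Final Final-consistent inhabited))
      ... | no ¬inhabited with u , empty ← ¬∀⟶∃¬ _ _ (λ u → any? λ a → T? (χ (Final u) a)) ¬inhabited =
        inj₂ (u , λ a (E , E-consistent , a∈E) →
                    empty (a , Final-greatest E E-consistent (λ _ _ _ → tt) u a a∈E))

-- Being a core is implied by having all singleton relations.
proposition3p3 : (𝔸 : Structure) → IsCore 𝔸 → HasSingletons 𝔸 → Unbalanced 𝔸 → SolvableBy1Minimality 𝔸
proposition3p3 𝔸 _ hasSingletons unbalanced I =
  mk⇔ (trivial⇒unsolvable 𝔸 I) (unsolvable⇒trivial 𝔸 I hasSingletons unbalanced)
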